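{- If $\Gamma\vdash_s M:A\to B$ is derivable in $\Lambda_\cap^s$ and $x\notin\Gamma$, then $\Gamma,x:A\vdash_s Mx:B$ is derivable in $\Lambda_\cap^s$.
   Context: $\lambda$-terms: $M::=x\mid MM\mid\lambda x.M$ modulo $\alpha$-conversion; $M[x:=N]$ capture-avoiding substitution. Types: $A::=\varphi\mid A\to A\mid A\cap A$. A typing context is a finite set of pairs $x:A$, where a variable may occur with several types; $\Gamma,x:A$ denotes $\Gamma\cup\{x:A\}$; $x\notin\Gamma$ means no $x:C$ lies in $\Gamma$. Rules of $\Lambda_\cap^s$ ($n\ge0$): (Ax) $\Gamma,x:A\vdash_s x:A$; $(\mathsf{Beta})^s$ from $\Gamma\vdash_s M[x:=N]N_1\dots N_n:A$ and $\Gamma\vdash_s N:B$ infer $\Gamma\vdash_s(\lambda x.M)NN_1\dots N_n:A$; $(\mathsf{L}\to)$ from $\Gamma\vdash_s N:A_1$ and $\Gamma,y:A_2\vdash_s yN_1\dots N_n:B$, with $y\notin FV(N_1)\cup\dots\cup FV(N_n)$, $y\notin\Gamma$, infer $\Gamma,x:A_1\to A_2\vdash_s xNN_1\dots N_n:B$; $(\mathsf{R}\to)$ from $\Gamma,x:A\vdash_s M:B$, $x\notin\Gamma$, infer $\Gamma\vdash_s\lambda x.M:A\to B$; $(\mathsf{L}\cap)$ from $\Gamma,x:A_1,x:A_2\vdash_s xN_1\dots N_n:B$ infer $\Gamma,x:A_1\cap A_2\vdash_s xN_1\dots N_n:B$; $(\mathsf{R}\cap)$ from $\Gamma\vdash_s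 M:A$ and $\Gamma\vdash_s M:B$ infer $\Gamma\vdash_s M:A\cap B$. -}

module Defs where

open import Data.Nat using (ℕ; zero; suc; _≡ᵇ_)
open import Data.Fin using (Fin; zero; suc; punchIn)
open import Data.Bool using (if_then_else_)
open import Data.List using (List; []; _∷_; foldl)
open import Data.List.Relation.Unary.All using (All)
open import Data.List.Membership.Propositional using (_∈_; _∉_)
open import Data.Product using (_×_; _,_)
open import Function.Bundles using (_⇔_)
open import Relation.Nullary using (¬_)

Var : Set
Var = ℕ

infixr 7 _⇒_
infixr 8 _∩_

data Ty : Set where
  atom : ℕ → Ty
  _⇒_  : Ty → Ty → Ty
  _∩_  : Ty → Ty → Ty

-- λ-terms modulo α-conversion, represented in the locally nameless
-- style with well-scoped de Bruijn indices for bound variables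
-- (bvar zero = innermost binder) and names (ℕ) for free variables.
-- Tm 0 is in bijection with α-classes of named λ-terms.

data Tm (n : ℕ) : Set where
  bvar : Fin n → Tm n
  fvar : Var → Tm n
  app  : Tm n → Tm n → Tm n
  lam  : Tm (suc n) → Tm n

Term : Set
Term = Tm 0

ext : ∀ {m k} → (Fin m → Fin k) → Fin (suc m) → Fin (suc k)
ext ρ zero    = zero
ext ρ (suc i) = suc (ρ i)

rename : ∀ {m k} → (Fin m → Fin k) → Tm m → Tm k
rename ρ (bvar i)  = bvar (ρ i)
rename ρ (fvar y)  = fvar y
rename ρ (app s t) = app (rename ρ s) (rename ρ t)
rename ρ (lam t)   = lam (rename (ext ρ) t)

wk0 : ∀ {n} → Tm 0 → Tm n
wk0 = rename (λ ())

closeAt : ∀ {n} → Var → Fin (suc n) → Tm n → Tm (suc n)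
closeAt x k (bvar i)  = bvar (punchIn k i)
closeAt x k (fvar y)  = if x ≡ᵇ y then bvar k else fvar y
closeAt x k (app s t) = app (closeAt x k s) (closeAt x k t)
closeAt x k (lam t)   = lam (closeAt x (suc k) t)

ƛ : Var → Term → Term
ƛ x M = lam (closeAt x zero M)

-- M[x:=N] (capture-avoiding: N has no dangling bound indices)
substF : ∀ {n} → Var → Term → Tm n → Tm n
substF x N (bvar i)  = bvar i
substF x N (fvar y)  = if x ≡ᵇ y then wk0 N else fvar y
substF x N (app s t) = app (substF x N s) (substF x N t)
substF x N (lam t)   = lam (substF x N t)

_[_:=_] : Term → Var → Term → Term
M [ x := N ] = substF x N M

infixl 6 _·⋆_
_·⋆_ : Term → List Term → Term
M ·⋆ Ns = foldl app M Ns

data _∈FV_ {n : ℕ} (y : Var) : Tm n → Set where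
  here : y ∈FV fvar y
  appˡ : ∀ {s t} → y ∈FV s → y ∈FV app s t
  appʳ : ∀ {s t} → y ∈FV t → y ∈FV app s t
  lamᵇ : ∀ {t} → y ∈FV t → y ∈FV lam t

_∉FVs_ : Var → List Term → Set
y ∉FVs Ns = All (λ N → ¬ (y ∈FV N)) Ns

-- Typing contexts: finite sets of pairs x:A, represented by lists
-- considered up to having the same elements.

Ctx : Set
Ctx = List (Var × Ty)

_≋_ : Ctx → Ctx → Set
Γ ≋ Δ = ∀ p → (p ∈ Γ) ⇔ (p ∈ Δ)

_∉ctx_ : Var → Ctx → Set
x ∉ctx Γ = ∀ C → (x , C) ∉ Γ

-- The system Λ∩ˢ.  "Γ, x:A" in a conclusion is rendered as an arbitrary
-- context Δ with the same elements as (x , A) ∷ Γ (i.e. Δ = Γ ∪ {x:A}).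

infix 4 _⊢ₛ_∶_

data _⊢ₛ_∶_ : Ctx → Term → Ty → Set where
  Ax   : ∀ {Γ Δ x A} → Δ ≋ ((x , A) ∷ Γ) → Δ ⊢ₛ fvar x ∶ A
  Beta : ∀ {Γ x M N Ns A B} →
         Γ ⊢ₛ (M [ x := N ]) ·⋆ Ns ∶ A → Γ ⊢ₛ N ∶ B →
         Γ ⊢ₛ app (ƛ x M) N ·⋆ Ns ∶ A
  L⇒   : ∀ {Γ Δ x y N Ns A₁ A₂ B} →
         Γ ⊢ₛ N ∶ A₁ → ((y , A₂) ∷ Γ) ⊢ₛ fvar y ·⋆ Ns ∶ B →
         y ∉FVs Ns → y ∉ctx Γ →
         Δ ≋ ((x , A₁ ⇒ A₂) ∷ Γ) →
         Δ ⊢ₛ fvar x ·⋆ (N ∷ Ns) ∶ B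
  R⇒   : ∀ {Γ x M A B} →
         ((x , A) ∷ Γ) ⊢ₛ M ∶ B → x ∉ctx Γ →
         Γ ⊢ₛ ƛ x M ∶ A ⇒ B
  L∩   : ∀ {Γ Δ x Ns A₁ A₂ B} →
         ((x , A₁) ∷ (x , A₂) ∷ Γ) ⊢ₛ fvar x ·⋆ Ns ∶ B →
         Δ ≋ ((x , A₁ ∩ A₂) ∷ Γ) →
         Δ ⊢ₛ fvar x ·⋆ Ns ∶ B
  R∩   : ∀ {Γ M A B} → Γ ⊢ₛ M ∶ A → Γ ⊢ₛ M ∶ B → Γ ⊢ₛ M ∶ A ∩ B

-- Induct on the derivation of Γ ⊢ M : A → B (rule R∩ cannot end it).  In the spine rules
-- Beta, L→ and L∩ the new argument x is appended to the spine of the premise, (Ax) becomes an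
-- instance of L→ with trivial premises, and for M = λy.M′ derived by R→ the goal is a Beta step
-- whose contractum M′[y:=x] is typed by the premise with y renamed to x.
-- The eigenvariables of L→ and R→ must be fresh, so they may clash with x or with a larger
-- context; they are then swapped for fresh names.  To keep the induction structural, weakening
-- and the theorem itself are proved for terms transported along an injective renaming of free
-- names into a context containing the renamed one.
module Submission where

open import Defs
open import Data.Bool using (true; false; if_then_else_)
open import Data.Empty using (⊥-elim)
open import Data.Fin using (Fin; zero; suc)
open import Data.List using ([]; _∷_; _∷ʳ_; map)
open import Data.List.Properties using (foldl-∷ʳ; map-cong-local)
open import Data.List.Membership.Propositional using (_∈_; lose)
open import Data.List.Relation.Unary.All as All using (All; []; _∷_)
open import Data.List.Relation.Unary.All.Properties using (∷ʳ⁺) renaming (map⁺ to All-map⁺)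
open import Data.List.Relation.Unary.Any using (Any; here; there)
open import Data.List.Relation.Binary.Subset.Propositional using (_⊆_)
open import Data.List.Relation.Binary.Subset.Propositional.Properties using (⊆-reflexive-↭)
open import Data.List.Relation.Binary.Permutation.Propositional using (↭-swap; ↭-prep; ↭-refl; ↭-trans)
open import Data.Nat using (ℕ; suc; _≡ᵇ_; _⊔_; _≤_)
open import Data.Nat.Properties using (_≟_; m≤m⊔n; m≤n⊔m; ≤-trans; n≮n)
open import Data.Product using (∃; _×_; _,_)
open import Data.Sum using (_⊎_; inj₁; inj₂)
open import Function using (_∘_)
open import Function.Bundles using (Equivalence; mk⇔)
open import Function.Definitions using (Injective)
open import Relation.Nullary using (¬_; yes; no; proof)
open import Relation.Nullary.Reflects using (Reflects; ofʸ; ofⁿ)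
open import Relation.Binary.PropositionalEquality

-- _≟_ on ℕ is computed by _≡ᵇ_, so its proof component already reflects _≡ᵇ_.
≡ᵇ-reflects : ∀ m n → Reflects (m ≡ n) (m ≡ᵇ n)
≡ᵇ-reflects m n = proof (m ≟ n)

≡ᵇ-injective : ∀ {f : Var → Var} → Injective _≡_ _≡_ f → ∀ x y → (f x ≡ᵇ f y) ≡ (x ≡ᵇ y)
≡ᵇ-injective {f} f-inj x y with f x ≡ᵇ f y | ≡ᵇ-reflects (f x) (f y) | x ≡ᵇ y | ≡ᵇ-reflects x y
... | true  | _         | true  | _        = refl
... | false | _         | false | _        = refl
... | true  | ofʸ fx≡fy | false | ofⁿ x≢y  = ⊥-elim (x≢y (f-inj fx≡fy))
... | false | ofⁿ fx≢fy | true  | ofʸ refl = ⊥-elim (fx≢fy refl)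

replace : Var → Var → Var → Var
replace a b w = if a ≡ᵇ w then b else w

replace-self : ∀ a b → replace a b a ≡ b
replace-self a b with a ≡ᵇ a | ≡ᵇ-reflects a a
... | true  | _       = refl
... | false | ofⁿ a≢a = ⊥-elim (a≢a refl)

replace-other : ∀ {a b w} → a ≢ w → replace a b w ≡ w
replace-other {a} {w = w} a≢w with a ≡ᵇ w | ≡ᵇ-reflects a w
... | true  | ofʸ a≡w = ⊥-elim (a≢w a≡w)
... | false | _       = refl

-- Renaming free names

renameFV : ∀ {n} → (Var → Var) → Tm n → Tm n
renameFV f (bvar i)  = bvar i
renameFV f (fvar y)  = fvar (f y)
renameFV f (app s t) = app (renameFV f s) (renameFV f t)
renameFV f (lam t)   = lam (renameFV f t)

renameFV-id : ∀ {n} (t : Tm n) → renameFV (λ w → w) t ≡ t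
renameFV-id (bvar i)  = refl
renameFV-id (fvar y)  = refl
renameFV-id (app s t) = cong₂ app (renameFV-id s) (renameFV-id t)
renameFV-id (lam t)   = cong lam (renameFV-id t)

renameFV-∘ : ∀ {n} f g (t : Tm n) → renameFV g (renameFV f t) ≡ renameFV (g ∘ f) t
renameFV-∘ f g (bvar i)  = refl
renameFV-∘ f g (fvar y)  = refl
renameFV-∘ f g (app s t) = cong₂ app (renameFV-∘ f g s) (renameFV-∘ f g t)
renameFV-∘ f g (lam t)   = cong lam (renameFV-∘ f g t)

renameFV-rename : ∀ {m k} f (ρ : Fin m → Fin k) (t : Tm m) →
                  renameFV f (rename ρ t) ≡ rename ρ (renameFV f t)
renameFV-rename f ρ (bvar i)  = refl
renameFV-rename f ρ (fvar y)  = refl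
renameFV-rename f ρ (app s t) = cong₂ app (renameFV-rename f ρ s) (renameFV-rename f ρ t)
renameFV-rename f ρ (lam t)   = cong lam (renameFV-rename f (ext ρ) t)

module _ {f : Var → Var} (f-inj : Injective _≡_ _≡_ f) where

  renameFV-closeAt : ∀ {n} x (k : Fin (suc n)) (t : Tm n) →
                     renameFV f (closeAt x k t) ≡ closeAt (f x) k (renameFV f t)
  renameFV-closeAt x k (bvar i) = refl
  renameFV-closeAt x k (fvar y) rewrite ≡ᵇ-injective f-inj x y with x ≡ᵇ y
  ... | true  = refl
  ... | false = refl
  renameFV-closeAt x k (app s t) = cong₂ app (renameFV-closeAt x k s) (renameFV-closeAt x k t)
  renameFV-closeAt x k (lam t)   = cong lam (renameFV-closeAt x (suc k) t)

  renameFV-ƛ : ∀ x M → renameFV f (ƛ x M) ≡ ƛ (f x) (renameFV f M)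
  renameFV-ƛ x M = cong lam (renameFV-closeAt x zero M)

  renameFV-redex : ∀ x M N → renameFV f (app (ƛ x M) N) ≡ app (ƛ (f x) (renameFV f M)) (renameFV f N)
  renameFV-redex x M N = cong (λ t → app t (renameFV f N)) (renameFV-ƛ x M)

  renameFV-substF : ∀ {n} x N (t : Tm n) →
                    renameFV f (substF x N t) ≡ substF (f x) (renameFV f N) (renameFV f t)
  renameFV-substF x N (bvar i) = refl
  renameFV-substF x N (fvar y) rewrite ≡ᵇ-injective f-inj x y with x ≡ᵇ y
  ... | true  = renameFV-rename f (λ ()) N
  ... | false = refl
  renameFV-substF x N (app s t) = cong₂ app (renameFV-substF x N s) (renameFV-substF x N t)
  renameFV-substF x N (lam t)   = cong lam (renameFV-substF x N t)

substF-fvar : ∀ {n} a b (t : Tm n) → substF a (fvar b) t ≡ renameFV (replace a b) t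
substF-fvar a b (bvar i) = refl
substF-fvar a b (fvar y) with a ≡ᵇ y
... | true  = refl
... | false = refl
substF-fvar a b (app s t) = cong₂ app (substF-fvar a b s) (substF-fvar a b t)
substF-fvar a b (lam t)   = cong lam (substF-fvar a b t)

renameFV-·⋆ : ∀ f {M M′} Ns → renameFV f M ≡ M′ →
              renameFV f (M ·⋆ Ns) ≡ M′ ·⋆ map (renameFV f) Ns
renameFV-·⋆ f []       head≡ = head≡
renameFV-·⋆ f (N ∷ Ns) head≡ = renameFV-·⋆ f Ns (cong (λ t → app t (renameFV f N)) head≡)

·⋆-∷ʳ : ∀ M Ns P → app (M ·⋆ Ns) P ≡ M ·⋆ (Ns ∷ʳ P)
·⋆-∷ʳ M Ns P = sym (foldl-∷ʳ app M P Ns)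

renameFV-·⋆-∷ʳ : ∀ f {M M′} Ns P → renameFV f M ≡ M′ →
                 app (renameFV f (M ·⋆ Ns)) P ≡ M′ ·⋆ (map (renameFV f) Ns ∷ʳ P)
renameFV-·⋆-∷ʳ f Ns P head≡ =
  trans (cong (λ t → app t P) (renameFV-·⋆ f Ns head≡)) (·⋆-∷ʳ _ (map (renameFV f) Ns) P)

∈FV-·⋆ : ∀ {w} M Ns → w ∈FV (M ·⋆ Ns) → w ∈FV M ⊎ Any (w ∈FV_) Ns
∈FV-·⋆ M []       p = inj₁ p
∈FV-·⋆ M (N ∷ Ns) p with ∈FV-·⋆ (app M N) Ns p
... | inj₁ (appˡ q) = inj₁ q
... | inj₁ (appʳ q) = inj₂ (here q)
... | inj₂ q        = inj₂ (there q)

∈FV-·⋆ˡ : ∀ {w M} Ns → w ∈FV M → w ∈FV (M ·⋆ Ns)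
∈FV-·⋆ˡ []       p = p
∈FV-·⋆ˡ (N ∷ Ns) p = ∈FV-·⋆ˡ Ns (appˡ p)

∈FV-·⋆ʳ : ∀ {w} M {Ns} → Any (w ∈FV_) Ns → w ∈FV (M ·⋆ Ns)
∈FV-·⋆ʳ M {N ∷ Ns} (here p)  = ∈FV-·⋆ˡ Ns (appʳ p)
∈FV-·⋆ʳ M {N ∷ Ns} (there q) = ∈FV-·⋆ʳ (app M N) q

∈FV-closeAt : ∀ {n w y} k (t : Tm n) → w ∈FV closeAt y k t → y ≢ w × w ∈FV t
∈FV-closeAt {y = y} k (fvar v) p with y ≡ᵇ v | ≡ᵇ-reflects y v
∈FV-closeAt k (fvar v) ()   | true  | _
∈FV-closeAt k (fvar v) here | false | ofⁿ y≢v = y≢v , here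
∈FV-closeAt k (app s t) (appˡ p) with ∈FV-closeAt k s p
... | y≢w , q = y≢w , appˡ q
∈FV-closeAt k (app s t) (appʳ p) with ∈FV-closeAt k t p
... | y≢w , q = y≢w , appʳ q
∈FV-closeAt k (lam t) (lamᵇ p) with ∈FV-closeAt (suc k) t p
... | y≢w , q = y≢w , lamᵇ q

∈FV-substF : ∀ {n w x} N (t : Tm n) → x ≢ w → w ∈FV t → w ∈FV substF x N t
∈FV-substF {x = x} N (fvar w) x≢w here with x ≡ᵇ w | ≡ᵇ-reflects x w
... | true  | ofʸ x≡w = ⊥-elim (x≢w x≡w)
... | false | _       = here
∈FV-substF N (app s t) x≢w (appˡ p) = appˡ (∈FV-substF N s x≢w p)
∈FV-substF N (app s t) x≢w (appʳ p) = appʳ (∈FV-substF N t x≢w p)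
∈FV-substF N (lam t)   x≢w (lamᵇ p) = lamᵇ (∈FV-substF N t x≢w p)

-- Contexts, scoping and fresh names

_∈dom_ : Var → Ctx → Set
w ∈dom Γ = ∃ λ C → (w , C) ∈ Γ

Scoped : ∀ {n} → Ctx → Tm n → Set
Scoped Γ t = ∀ {w} → w ∈FV t → w ∈dom Γ

∉ctx-≢ : ∀ {z w C Γ} → z ∉ctx Γ → (w , C) ∈ Γ → z ≢ w
∉ctx-≢ z∉Γ w∈Γ refl = z∉Γ _ w∈Γ

∉ctx-∷ : ∀ {z w C Γ} → z ≢ w → z ∉ctx Γ → z ∉ctx ((w , C) ∷ Γ)
∉ctx-∷ z≢w z∉Γ C (here refl)  = z≢w refl
∉ctx-∷ z≢w z∉Γ C (there z∈Γ) = z∉Γ C z∈Γ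

∉ctx-∉FV : ∀ {n z Γ} {t : Tm n} → z ∉ctx Γ → Scoped Γ t → ¬ z ∈FV t
∉ctx-∉FV z∉Γ t-scoped p with t-scoped p
... | C , z∈Γ = z∉Γ C z∈Γ

≋-refl : ∀ {Γ} → Γ ≋ Γ
≋-refl _ = mk⇔ (λ m → m) (λ m → m)

≋-head : ∀ {Δ p Γ} → Δ ≋ (p ∷ Γ) → p ∈ Δ
≋-head Δ≋ = Equivalence.from (Δ≋ _) (here refl)

≋-tail : ∀ {Δ p Γ} → Δ ≋ (p ∷ Γ) → Γ ⊆ Δ
≋-tail Δ≋ m = Equivalence.from (Δ≋ _) (there m)

≋-absorb : ∀ {p Γ} → p ∈ Γ → Γ ≋ (p ∷ Γ)
≋-absorb p∈Γ _ = mk⇔ there (λ { (here refl) → p∈Γ ; (there m) → m })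

maxVar : Ctx → ℕ
maxVar []            = 0
maxVar ((w , _) ∷ Γ) = w ⊔ maxVar Γ

≤-maxVar : ∀ {w C} Γ → (w , C) ∈ Γ → w ≤ maxVar Γ
≤-maxVar ((v , _) ∷ Γ) (here refl) = m≤m⊔n v (maxVar Γ)
≤-maxVar ((v , _) ∷ Γ) (there m)   = ≤-trans (≤-maxVar Γ m) (m≤n⊔m v (maxVar Γ))

fresh : Ctx → Var
fresh Γ = suc (maxVar Γ)

fresh-∉ctx : ∀ Γ → fresh Γ ∉ctx Γ
fresh-∉ctx Γ C m = n≮n (maxVar Γ) (≤-maxVar Γ m)

swap : Var → Var → Var → Var
swap a b w with w ≟ a
... | yes _ = b
... | no _ with w ≟ b
...   | yes _ = a
...   | no _  = w

swap-left : ∀ a b → swap a b a ≡ b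
swap-left a b with a ≟ a
... | yes _   = refl
... | no a≢a = ⊥-elim (a≢a refl)

swap-right : ∀ a b → swap a b b ≡ a
swap-right a b with b ≟ a
... | yes b≡a = b≡a
... | no _ with b ≟ b
...   | yes _   = refl
...   | no b≢b = ⊥-elim (b≢b refl)

swap-other : ∀ {a b w} → a ≢ w → b ≢ w → swap a b w ≡ w
swap-other {a} {b} {w} a≢w b≢w with w ≟ a
... | yes w≡a = ⊥-elim (a≢w (sym w≡a))
... | no _ with w ≟ b
...   | yes w≡b = ⊥-elim (b≢w (sym w≡b))
...   | no _    = refl

swap-involutive : ∀ a b w → swap a b (swap a b w) ≡ w
swap-involutive a b w with w ≟ a
... | yes refl = swap-right w b
... | no w≢a with w ≟ b
...   | yes refl = swap-left a w
...   | no w≢b   = swap-other (w≢a ∘ sym) (w≢b ∘ sym)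

swap-injective : ∀ a b → Injective _≡_ _≡_ (swap a b)
swap-injective a b {u} {v} eq = begin
  u                     ≡⟨ swap-involutive a b u ⟨
  swap a b (swap a b u) ≡⟨ cong (swap a b) eq ⟩
  swap a b (swap a b v) ≡⟨ swap-involutive a b v ⟩
  v                     ∎
  where open ≡-Reasoning

_⊆⟨_⟩_ : Ctx → (Var → Var) → Ctx → Set
Γ ⊆⟨ π ⟩ Γ′ = ∀ {w C} → (w , C) ∈ Γ → (π w , C) ∈ Γ′

⊆⟨⟩-∷ : ∀ {π Γ Γ′ w C} → Γ ⊆⟨ π ⟩ Γ′ → ((w , C) ∷ Γ) ⊆⟨ π ⟩ ((π w , C) ∷ Γ′)
⊆⟨⟩-∷ Γ⊆Γ′ (here refl) = here refl
⊆⟨⟩-∷ Γ⊆Γ′ (there m)   = there (Γ⊆Γ′ m)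

scoped-renameFV : ∀ {n π Γ Γ′} {t : Tm n} → Γ ⊆⟨ π ⟩ Γ′ → Scoped Γ t → Scoped Γ′ (renameFV π t)
scoped-renameFV {t = fvar y} Γ⊆Γ′ t-scoped here with t-scoped here
... | C , y∈Γ = C , Γ⊆Γ′ y∈Γ
scoped-renameFV {t = app s u} Γ⊆Γ′ t-scoped (appˡ p) = scoped-renameFV Γ⊆Γ′ (t-scoped ∘ appˡ) p
scoped-renameFV {t = app s u} Γ⊆Γ′ t-scoped (appʳ p) = scoped-renameFV Γ⊆Γ′ (t-scoped ∘ appʳ) p
scoped-renameFV {t = lam s}   Γ⊆Γ′ t-scoped (lamᵇ p) = scoped-renameFV Γ⊆Γ′ (t-scoped ∘ lamᵇ) p

renameFV-cong : ∀ {n f g Γ} {t : Tm n} → (∀ {w} → w ∈dom Γ → f w ≡ g w) → Scoped Γ t →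
                renameFV f t ≡ renameFV g t
renameFV-cong {t = bvar i}  f≗g t-scoped = refl
renameFV-cong {t = fvar y}  f≗g t-scoped = cong fvar (f≗g (t-scoped here))
renameFV-cong {t = app s u} f≗g t-scoped =
  cong₂ app (renameFV-cong f≗g (t-scoped ∘ appˡ)) (renameFV-cong f≗g (t-scoped ∘ appʳ))
renameFV-cong {t = lam s}   f≗g t-scoped = cong lam (renameFV-cong f≗g (t-scoped ∘ lamᵇ))

-- Sends z to z′ as an update of π would, but stays injective.
redirect : (Var → Var) → Var → Var → Var → Var
redirect π z z′ = swap (π z) z′ ∘ π

redirect-injective : ∀ {π} z z′ → Injective _≡_ _≡_ π → Injective _≡_ _≡_ (redirect π z z′)
redirect-injective {π} z z′ π-inj = π-inj ∘ swap-injective (π z) z′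

module _ {π Γ Γ′ z z′} (π-inj : Injective _≡_ _≡_ π) (Γ⊆Γ′ : Γ ⊆⟨ π ⟩ Γ′)
         (z∉Γ : z ∉ctx Γ) (z′∉Γ′ : z′ ∉ctx Γ′) where

  redirect-fixes : ∀ {w} → w ∈dom Γ → redirect π z z′ w ≡ π w
  redirect-fixes (C , w∈Γ) = swap-other (∉ctx-≢ z∉Γ w∈Γ ∘ π-inj) (∉ctx-≢ z′∉Γ′ (Γ⊆Γ′ w∈Γ))

  ⊆⟨⟩-redirect : ∀ {A} → ((z , A) ∷ Γ) ⊆⟨ redirect π z z′ ⟩ ((z′ , A) ∷ Γ′)
  ⊆⟨⟩-redirect (here refl) = here (cong (_, _) (swap-left (π z) z′))
  ⊆⟨⟩-redirect (there w∈Γ) =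
    there (subst (λ v → (v , _) ∈ Γ′) (sym (redirect-fixes (_ , w∈Γ))) (Γ⊆Γ′ w∈Γ))

  renameFV-redirect-spine : ∀ {Ns} → All (Scoped Γ) Ns →
                            renameFV (redirect π z z′) (fvar z ·⋆ Ns) ≡ fvar z′ ·⋆ map (renameFV π) Ns
  renameFV-redirect-spine {Ns} Ns-scoped =
    trans (renameFV-·⋆ _ Ns (cong fvar (swap-left (π z) z′)))
          (cong (fvar z′ ·⋆_) (map-cong-local (All.map (renameFV-cong redirect-fixes) Ns-scoped)))

∉FVs-renameFV : ∀ {π Γ Γ′ z Ns} → Γ ⊆⟨ π ⟩ Γ′ → z ∉ctx Γ′ → All (Scoped Γ) Ns →
                z ∉FVs map (renameFV π) Ns
∉FVs-renameFV Γ⊆Γ′ z∉Γ′ Ns-scoped =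
  All-map⁺ (All.map (∉ctx-∉FV z∉Γ′ ∘ scoped-renameFV Γ⊆Γ′) Ns-scoped)

scoped-ƛ : ∀ {Γ y A M} → Scoped ((y , A) ∷ Γ) M → Scoped Γ (ƛ y M)
scoped-ƛ M-scoped (lamᵇ p) with ∈FV-closeAt zero _ p
... | y≢w , q with M-scoped q
...   | C , here refl = ⊥-elim (y≢w refl)
...   | C , there w∈Γ = C , w∈Γ

scoped-spine : ∀ {Γ x Ns} → x ∈dom Γ → All (Scoped Γ) Ns → Scoped Γ (fvar x ·⋆ Ns)
scoped-spine {Ns = Ns} x∈Γ Ns-scoped p with ∈FV-·⋆ _ Ns p
... | inj₁ here = x∈Γ
... | inj₂ q with All.lookupAny Ns-scoped q
...   | N-scoped , r = N-scoped r

scoped-β : ∀ {Γ y M N Ns} → Scoped Γ ((M [ y := N ]) ·⋆ Ns) → Scoped Γ N →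
           Scoped Γ (app (ƛ y M) N ·⋆ Ns)
scoped-β {M = M} {N} {Ns} contractum-scoped N-scoped p with ∈FV-·⋆ _ Ns p
... | inj₁ (appˡ (lamᵇ q)) with ∈FV-closeAt zero M q
...   | y≢w , r = contractum-scoped (∈FV-·⋆ˡ Ns (∈FV-substF N M y≢w r))
scoped-β contractum-scoped N-scoped p | inj₁ (appʳ q) = N-scoped q
scoped-β contractum-scoped N-scoped p | inj₂ q = contractum-scoped (∈FV-·⋆ʳ _ q)

args-scoped : ∀ {Γ z A Ns} → Scoped ((z , A) ∷ Γ) (fvar z ·⋆ Ns) → z ∉FVs Ns → All (Scoped Γ) Ns
args-scoped {Γ} {z} {Ns = Ns} spine-scoped z∉Ns = All.tabulate arg-scoped
  where
  arg-scoped : ∀ {N} → N ∈ Ns → Scoped Γ N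
  arg-scoped N∈Ns p with spine-scoped (∈FV-·⋆ʳ (fvar z) (lose N∈Ns p))
  ... | C , here refl = ⊥-elim (All.lookup z∉Ns N∈Ns p)
  ... | C , there w∈Γ = C , w∈Γ

⊢-scoped : ∀ {Γ M C} → Γ ⊢ₛ M ∶ C → Scoped Γ M
⊢-scoped (Ax Γ≋) here = _ , ≋-head Γ≋
⊢-scoped (Beta {x = y} {M} {N} {Ns} D₁ D₂) = scoped-β {y = y} {M} {N} {Ns} (⊢-scoped D₁) (⊢-scoped D₂)
⊢-scoped {Γ} (L⇒ {Γ = Γ₀} D₁ D₂ z∉Ns _ Γ≋) =
  scoped-spine (_ , ≋-head Γ≋)
    (weaken (⊢-scoped D₁) ∷ All.map weaken (args-scoped (⊢-scoped D₂) z∉Ns))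
  where
  weaken : ∀ {N} → Scoped Γ₀ N → Scoped Γ N
  weaken N-scoped p with N-scoped p
  ... | C , w∈Γ₀ = C , ≋-tail Γ≋ w∈Γ₀
⊢-scoped (R⇒ D _) = scoped-ƛ (⊢-scoped D)
⊢-scoped (L∩ D Γ≋) p with ⊢-scoped D p
... | _ , here refl          = _ , ≋-head Γ≋
... | _ , there (here refl)  = _ , ≋-head Γ≋
... | C , there (there w∈Γ₀) = C , ≋-tail Γ≋ w∈Γ₀
⊢-scoped (R∩ D₁ _) = ⊢-scoped D₁

-- Weakening along an injective renaming

⊢-≡ : ∀ {Γ M M′ C} → M ≡ M′ → Γ ⊢ₛ M ∶ C → Γ ⊢ₛ M′ ∶ C
⊢-≡ = subst (_ ⊢ₛ_∶ _)

⊢-rename : ∀ {Γ Γ′ M C} π → Injective _≡_ _≡_ π → Γ ⊆⟨ π ⟩ Γ′ →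
           Γ ⊢ₛ M ∶ C → Γ′ ⊢ₛ renameFV π M ∶ C
⊢-rename π π-inj Γ⊆Γ′ (Ax Γ≋) = Ax (≋-absorb (Γ⊆Γ′ (≋-head Γ≋)))
⊢-rename π π-inj Γ⊆Γ′ (Beta {x = y} {M} {N} {Ns} D₁ D₂) =
  ⊢-≡ (sym (renameFV-·⋆ π Ns (renameFV-redex π-inj y M N)))
    (Beta {x = π y} {renameFV π M} {Ns = map (renameFV π) Ns}
      (⊢-≡ (renameFV-·⋆ π Ns (renameFV-substF π-inj y N M)) (⊢-rename π π-inj Γ⊆Γ′ D₁))
      (⊢-rename π π-inj Γ⊆Γ′ D₂))
⊢-rename {Γ′ = Γ′} {C = C} π π-inj Γ⊆Γ′ (L⇒ {Γ = Γ₀} {x = y} {y = z} {N} {Ns} {A₂ = A₂} D₁ D₂ z∉Ns z∉Γ₀ Γ≋) =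
  ⊢-≡ (sym (renameFV-·⋆ π (N ∷ Ns) refl))
    (L⇒ {Ns = map (renameFV π) Ns} (⊢-rename π π-inj Γ₀⊆Γ′ D₁) D₂′
        (∉FVs-renameFV Γ₀⊆Γ′ z′∉Γ′ Ns-scoped) z′∉Γ′ (≋-absorb (Γ⊆Γ′ (≋-head Γ≋))))
  where
  z′ = fresh Γ′
  z′∉Γ′ : z′ ∉ctx Γ′
  z′∉Γ′ = fresh-∉ctx Γ′
  Γ₀⊆Γ′ : Γ₀ ⊆⟨ π ⟩ Γ′
  Γ₀⊆Γ′ = Γ⊆Γ′ ∘ ≋-tail Γ≋
  Ns-scoped : All (Scoped Γ₀) Ns
  Ns-scoped = args-scoped (⊢-scoped D₂) z∉Ns
  D₂′ : ((z′ , A₂) ∷ Γ′) ⊢ₛ fvar z′ ·⋆ map (renameFV π) Ns ∶ C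
  D₂′ = ⊢-≡ (renameFV-redirect-spine π-inj Γ₀⊆Γ′ z∉Γ₀ z′∉Γ′ Ns-scoped)
            (⊢-rename (redirect π z z′) (redirect-injective z z′ π-inj)
                      (⊆⟨⟩-redirect π-inj Γ₀⊆Γ′ z∉Γ₀ z′∉Γ′) D₂)
⊢-rename {Γ′ = Γ′} π π-inj Γ⊆Γ′ (R⇒ {x = y} {M} D y∉Γ) =
  ⊢-≡ ƛ-renamed (R⇒ (⊢-rename π′ π′-inj (⊆⟨⟩-redirect π-inj Γ⊆Γ′ y∉Γ z′∉Γ′) D) z′∉Γ′)
  where
  z′ = fresh Γ′
  z′∉Γ′ : z′ ∉ctx Γ′
  z′∉Γ′ = fresh-∉ctx Γ′
  π′ = redirect π y z′
  π′-inj : Injective _≡_ _≡_ π′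
  π′-inj = redirect-injective y z′ π-inj
  ƛ-renamed : ƛ z′ (renameFV π′ M) ≡ renameFV π (ƛ y M)
  ƛ-renamed = begin
    ƛ z′ (renameFV π′ M)     ≡⟨ cong (λ v → ƛ v (renameFV π′ M)) (swap-left (π y) z′) ⟨
    ƛ (π′ y) (renameFV π′ M) ≡⟨ renameFV-ƛ π′-inj y M ⟨
    renameFV π′ (ƛ y M)      ≡⟨ renameFV-cong (redirect-fixes π-inj Γ⊆Γ′ y∉Γ z′∉Γ′)
                                              (scoped-ƛ (⊢-scoped D)) ⟩
    renameFV π (ƛ y M)       ∎
    where open ≡-Reasoning
⊢-rename π π-inj Γ⊆Γ′ (L∩ {x = y} {Ns} D Γ≋) =
  ⊢-≡ (sym spine≡)
    (L∩ {Ns = map (renameFV π) Ns}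
      (⊢-≡ spine≡ (⊢-rename π π-inj (⊆⟨⟩-∷ (⊆⟨⟩-∷ (Γ⊆Γ′ ∘ ≋-tail Γ≋))) D))
      (≋-absorb (Γ⊆Γ′ (≋-head Γ≋))))
  where
  spine≡ : renameFV π (fvar y ·⋆ Ns) ≡ fvar (π y) ·⋆ map (renameFV π) Ns
  spine≡ = renameFV-·⋆ π Ns refl
⊢-rename π π-inj Γ⊆Γ′ (R∩ D₁ D₂) = R∩ (⊢-rename π π-inj Γ⊆Γ′ D₁) (⊢-rename π π-inj Γ⊆Γ′ D₂)

⊢-weaken : ∀ {Γ Γ′ M C} → Γ ⊆ Γ′ → Γ ⊢ₛ M ∶ C → Γ′ ⊢ₛ M ∶ C
⊢-weaken {M = M} Γ⊆Γ′ D = ⊢-≡ (renameFV-id M) (⊢-rename (λ w → w) (λ eq → eq) Γ⊆Γ′ D)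

-- Application to a fresh variable

⊢-app-fresh : ∀ {Γ Γ′ M A B x} π → Injective _≡_ _≡_ π → Γ ⊆⟨ π ⟩ Γ′ → x ∉ctx Γ′ →
              Γ ⊢ₛ M ∶ A ⇒ B → ((x , A) ∷ Γ′) ⊢ₛ app (renameFV π M) (fvar x) ∶ B
⊢-app-fresh {Γ′ = Γ′} {A = A} {x = x} π π-inj Γ⊆Γ′ x∉Γ′ (Ax Γ≋) =
  L⇒ {y = fresh ((x , A) ∷ Γ′)} {Ns = []} (Ax ≋-refl) (Ax ≋-refl) [] (fresh-∉ctx _)
     (≋-absorb (there (Γ⊆Γ′ (≋-head Γ≋))))
⊢-app-fresh {x = x} π π-inj Γ⊆Γ′ x∉Γ′ (Beta {x = y} {M} {N} {Ns} D₁ D₂) =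
  ⊢-≡ (sym (renameFV-·⋆-∷ʳ π Ns (fvar x) (renameFV-redex π-inj y M N)))
    (Beta {x = π y} {renameFV π M} {Ns = map (renameFV π) Ns ∷ʳ fvar x}
      (⊢-≡ (renameFV-·⋆-∷ʳ π Ns (fvar x) (renameFV-substF π-inj y N M))
           (⊢-app-fresh π π-inj Γ⊆Γ′ x∉Γ′ D₁))
      (⊢-rename π π-inj (there ∘ Γ⊆Γ′) D₂))
⊢-app-fresh {Γ′ = Γ′} {A = A} {B} {x} π π-inj Γ⊆Γ′ x∉Γ′
            (L⇒ {Γ = Γ₀} {x = y} {y = z} {N} {Ns} {A₂ = A₂} D₁ D₂ z∉Ns z∉Γ₀ Γ≋) =
  ⊢-≡ (sym (renameFV-·⋆-∷ʳ π (N ∷ Ns) (fvar x) refl))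
    (L⇒ {Ns = map (renameFV π) Ns ∷ʳ fvar x} (⊢-rename π π-inj (there ∘ Γ₀⊆Γ′) D₁) D₂′
        (∷ʳ⁺ (∉FVs-renameFV Γ₀⊆Γ′ z′∉Γ′ Ns-scoped) (∉ctx-∉FV z′∉xΓ′ λ { here → A , here refl }))
        z′∉xΓ′ (≋-absorb (there (Γ⊆Γ′ (≋-head Γ≋)))))
  where
  z′ = fresh ((x , A) ∷ Γ′)
  z′∉xΓ′ : z′ ∉ctx ((x , A) ∷ Γ′)
  z′∉xΓ′ = fresh-∉ctx _
  z′∉Γ′ : z′ ∉ctx Γ′
  z′∉Γ′ C = z′∉xΓ′ C ∘ there
  x≢z′ : x ≢ z′
  x≢z′ x≡z′ = z′∉xΓ′ A (here (cong (_, A) (sym x≡z′)))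
  Γ₀⊆Γ′ : Γ₀ ⊆⟨ π ⟩ Γ′
  Γ₀⊆Γ′ = Γ⊆Γ′ ∘ ≋-tail Γ≋
  Ns-scoped : All (Scoped Γ₀) Ns
  Ns-scoped = args-scoped (⊢-scoped D₂) z∉Ns
  spine≡ : app (renameFV (redirect π z z′) (fvar z ·⋆ Ns)) (fvar x)
           ≡ fvar z′ ·⋆ (map (renameFV π) Ns ∷ʳ fvar x)
  spine≡ = trans (cong (λ t → app t (fvar x))
                       (renameFV-redirect-spine π-inj Γ₀⊆Γ′ z∉Γ₀ z′∉Γ′ Ns-scoped))
                 (·⋆-∷ʳ _ (map (renameFV π) Ns) (fvar x))
  D₂′ : ((z′ , A₂) ∷ (x , A) ∷ Γ′) ⊢ₛ fvar z′ ·⋆ (map (renameFV π) Ns ∷ʳ fvar x) ∶ B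
  D₂′ = ⊢-weaken (⊆-reflexive-↭ (↭-swap _ _ ↭-refl))
          (⊢-≡ spine≡ (⊢-app-fresh (redirect π z z′) (redirect-injective z z′ π-inj)
                                    (⊆⟨⟩-redirect π-inj Γ₀⊆Γ′ z∉Γ₀ z′∉Γ′) (∉ctx-∷ x≢z′ x∉Γ′) D₂))
⊢-app-fresh {A = A} {x = x} π π-inj Γ⊆Γ′ x∉Γ′ (R⇒ {Γ = Γ} {x = y} {M} D y∉Γ) =
  ⊢-≡ (cong (λ t → app t (fvar x)) (sym (renameFV-ƛ π-inj y M)))
    (Beta {x = π y} {renameFV π M} {Ns = []}
      (⊢-≡ contractum≡ (⊢-rename π′ (redirect-injective y x π-inj)
                                   (⊆⟨⟩-redirect π-inj Γ⊆Γ′ y∉Γ x∉Γ′) D))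
      (Ax ≋-refl))
  where
  π′ = redirect π y x
  π′≗ : ∀ {w} → w ∈dom ((y , A) ∷ Γ) → π′ w ≡ replace (π y) x (π w)
  π′≗ (_ , here refl) = trans (swap-left (π y) x) (sym (replace-self (π y) x))
  π′≗ (_ , there w∈Γ) = trans (redirect-fixes π-inj Γ⊆Γ′ y∉Γ x∉Γ′ (_ , w∈Γ))
                               (sym (replace-other (∉ctx-≢ y∉Γ w∈Γ ∘ π-inj)))
  contractum≡ : renameFV π′ M ≡ renameFV π M [ π y := fvar x ]
  contractum≡ = begin
    renameFV π′ M                             ≡⟨ renameFV-cong π′≗ (⊢-scoped D) ⟩
    renameFV (replace (π y) x ∘ π) M          ≡⟨ renameFV-∘ π (replace (π y) x) M ⟨
    renameFV (replace (π y) x) (renameFV π M) ≡⟨ substF-fvar (π y) x (renameFV π M) ⟨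
    renameFV π M [ π y := fvar x ]            ∎
    where open ≡-Reasoning
⊢-app-fresh {Γ′ = Γ′} {A = A} {x = x} π π-inj Γ⊆Γ′ x∉Γ′
            (L∩ {x = y} {Ns} {A₁} {A₂} D Γ≋) =
  ⊢-≡ (sym spine≡)
    (L∩ {Ns = map (renameFV π) Ns ∷ʳ fvar x}
      (⊢-≡ spine≡ (⊢-weaken rotate (⊢-app-fresh π π-inj (⊆⟨⟩-∷ (⊆⟨⟩-∷ (Γ⊆Γ′ ∘ ≋-tail Γ≋))) x∉ D)))
      (≋-absorb (there πy∈Γ′)))
  where
  πy∈Γ′ : (π y , A₁ ∩ A₂) ∈ Γ′
  πy∈Γ′ = Γ⊆Γ′ (≋-head Γ≋)
  x≢πy : x ≢ π y
  x≢πy = ∉ctx-≢ x∉Γ′ πy∈Γ′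
  x∉ : x ∉ctx ((π y , A₁) ∷ (π y , A₂) ∷ Γ′)
  x∉ = ∉ctx-∷ x≢πy (∉ctx-∷ x≢πy x∉Γ′)
  spine≡ : app (renameFV π (fvar y ·⋆ Ns)) (fvar x) ≡ fvar (π y) ·⋆ (map (renameFV π) Ns ∷ʳ fvar x)
  spine≡ = renameFV-·⋆-∷ʳ π Ns (fvar x) refl
  rotate : (x , A) ∷ (π y , A₁) ∷ (π y , A₂) ∷ Γ′ ⊆ (π y , A₁) ∷ (π y , A₂) ∷ (x , A) ∷ Γ′
  rotate = ⊆-reflexive-↭ (↭-trans (↭-swap _ _ ↭-refl) (↭-prep _ (↭-swap _ _ ↭-refl)))

lemma2 : ∀ {Γ : Ctx} {M : Term} {A B : Ty} {x : Var} →
         Γ ⊢ₛ M ∶ A ⇒ B → x ∉ctx Γ →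
         ((x , A) ∷ Γ) ⊢ₛ app M (fvar x) ∶ B
lemma2 {M = M} {x = x} D x∉Γ =
  ⊢-≡ (cong (λ t → app t (fvar x)) (renameFV-id M))
      (⊢-app-fresh (λ w → w) (λ eq → eq) (λ m → m) x∉Γ D)
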